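{- Let $X$ be a concentric topological space whose regular open algebra $\mathrm{RO}(X)$ is atomless. Then at every point of $X$ there is a local basis that is a W-representative in $\langle\mathrm{RO}(X),\mathsf{C}_{\mathrm{T}}\rangle$.
   Context: A topological space $X$ is concentric iff it is $T_1$ and every $p\in X$ has a local basis $\mathcal{B}^p$ such that for all $U,V\in\mathcal{B}^p$: $U=V$ or $\mathrm{Cl}\,U\subseteq V$ or $\mathrm{Cl}\,V\subseteq U$. $\mathrm{RO}(X)$ is the Boolean algebra of regular open subsets with $x\cdot y=x\cap y$, $x+y=\mathrm{Int}\,\mathrm{Cl}(x\cup y)$, $-x=\mathrm{Int}(X\setminus x)$; contact $x\mathrel{\mathsf{C}_{\mathrm{T}}} y$ iff $\mathrm{Cl}\,x\cap\mathrm{Cl}\,y\neq\emptyset$; $x\ll y$ iff $\mathrm{Cl}\,x\subseteq y$. An abstractive set is a set $A$ of regions with (r0) $\emptyset\notin A$; (r1) for all $u,v\in A$: $u=v$ or $u\ll v$ or $v\ll u$; (A) there is no non-empty $x\in\mathrm{RO}(X)$ with $x\subseteq y$ for all $y\in A$. For sets of regions, $B\trianglelefteq A$ means: for every $a\in A$ there is $b\in B$ with $b\subseteq a$. An abstractive set $A$ is a W-representative iff for every abstractive set $B$, $B\trianglelefteq A$ implies $A\trianglelefteq B$. -}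

module Defs where

open import Level using (Level; 0ℓ; _⊔_) renaming (suc to lsuc)
open import Data.Product using (Σ; ∃; ∃-syntax; _×_; _,_)
open import Data.Sum using (_⊎_)
import Data.Unit
open import Relation.Nullary using (¬_)
open import Relation.Binary.PropositionalEquality using (_≡_)
open import Relation.Unary using (Pred; _∈_; _∉_; _⊆_; _≐_; Satisfiable; ∅; _∩_)

Subset : Set → Set₁
Subset X = Pred X 0ℓ

⋃[_] : {X I : Set} → (I → Subset X) → Subset X
⋃[ F ] x = ∃ λ i → F i x

record Topology (X : Set) : Set₁ where
  field
    Open       : Subset X → Set
    Open-resp  : ∀ {U V} → U ≐ V → Open U → Open V
    Open-univ  : Open (λ _ → Data.Unit.⊤)
    Open-∩     : ∀ {U V} → Open U → Open V → Open (U ∩ V)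
    Open-⋃     : ∀ {I : Set} (F : I → Subset X) → (∀ i → Open (F i)) → Open ⋃[ F ]

module _ {X : Set} (τ : Topology X) where
  open Topology τ

  Cl : ∀ {ℓ} → Pred X ℓ → Pred X (lsuc 0ℓ ⊔ ℓ)
  Cl A x = ∀ (U : Subset X) → Open U → x ∈ U → ∃ λ y → y ∈ U × y ∈ A

  Int : ∀ {ℓ} → Pred X ℓ → Pred X (lsuc 0ℓ ⊔ ℓ)
  Int A x = ∃ λ (U : Subset X) → Open U × x ∈ U × U ⊆ A

  T₁ : Set₁
  T₁ = ∀ (x y : X) → ¬ (x ≡ y) → ∃ λ (U : Subset X) → Open U × x ∈ U × y ∉ U

  IsLocalBasis : X → Pred (Subset X) 0ℓ → Set₁
  IsLocalBasis p ℬ =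
    (∀ U → U ∈ ℬ → Open U × p ∈ U) ×
    (∀ U → Open U → p ∈ U → ∃ λ V → V ∈ ℬ × V ⊆ U)

  Concentric : Set₁
  Concentric = T₁ × (∀ p → ∃ λ (ℬ : Pred (Subset X) 0ℓ) → IsLocalBasis p ℬ ×
      (∀ U V → U ∈ ℬ → V ∈ ℬ → (U ≐ V) ⊎ (Cl U ⊆ V) ⊎ (Cl V ⊆ U)))

  -- regular open sets (elements of RO(X)); equality of regions is extensional (≐)
  IsRegularOpen : Subset X → Set₁
  IsRegularOpen x = Open x × (Int (Cl x) ≐ x)

  -- the zero region is ∅; x ≠ 0 in RO(X) means ¬ (x ≐ ∅)
  -- atom of RO(X): nonzero, and every region below it is 0 or itself
  IsAtom : Subset X → Set₁
  IsAtom x = IsRegularOpen x × ¬ (x ≐ ∅) ×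
    (∀ y → IsRegularOpen y → y ⊆ x → (y ≐ ∅) ⊎ (y ≐ x))

  AtomlessRO : Set₁
  AtomlessRO = ∀ x → ¬ IsAtom x

  _≪_ : Subset X → Subset X → Set₁
  x ≪ y = Cl x ⊆ y

  IsAbstractive : Pred (Subset X) 0ℓ → Set₁
  IsAbstractive A =
    (∀ a → a ∈ A → IsRegularOpen a) ×
    (∀ a → a ∈ A → ¬ (a ≐ ∅)) ×
    (∀ u v → u ∈ A → v ∈ A → (u ≐ v) ⊎ (u ≪ v) ⊎ (v ≪ u)) ×
    (¬ (∃ λ x → IsRegularOpen x × Satisfiable x × (∀ y → y ∈ A → x ⊆ y)))  -- (A)

  _⊴_ : Pred (Subset X) 0ℓ → Pred (Subset X) 0ℓ → Set₁
  B ⊴ A = ∀ a → a ∈ A → ∃ λ b → b ∈ B × b ⊆ a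

  IsWRepresentative : Pred (Subset X) 0ℓ → Set₁
  IsWRepresentative A = IsAbstractive A ×
    (∀ (B : Pred (Subset X) 0ℓ) → IsAbstractive B → B ⊴ A → A ⊴ B)

{-# OPTIONS --safe #-}

-- Every member of a concentric local basis at p contains the closure of another member, so
-- replacing each member U by its regularization Int (Cl U) still gives a local basis at p,
-- now of regions forming a chain under ≪. Atomlessness makes ｛ p ｝ non-open, which is exactly what the
-- shrinking step and condition (A) need: a region below every basic neighbourhood of p lies
-- inside ｛ p ｝ by T₁. Finally, any abstractive local basis at p is a W-representative:
-- if an abstractive 𝒜 refines it, p lies in the closure of every member of 𝒜, and then, by (A),
-- in every member of 𝒜, so each member of 𝒜 contains a basic neighbourhood of p.

module Submission where

open import Defs
open import Level using (Level; 0ℓ)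
open import Axiom.ExcludedMiddle using (ExcludedMiddle)
open import Axiom.DoubleNegationElimination using (em⇒dne)
open import Data.Product using (∃; Σ; _×_; _,_; proj₁; proj₂)
open import Data.Sum using (_⊎_; inj₁; inj₂)
open import Data.Empty using (⊥-elim)
open import Relation.Nullary using (¬_; yes; no)
open import Relation.Nullary.Decidable using (True; toWitness; fromWitness)
open import Relation.Unary using (Pred; _∈_; _⊆_; _≐_; Satisfiable; ∅; _∩_; ｛_｝)
open import Relation.Binary.PropositionalEquality using (_≡_; refl; sym; subst)

module _ {X : Set} (τ : Topology X) where
  open Topology τ

  ⊆-Cl : ∀ {ℓ} {A : Pred X ℓ} → A ⊆ Cl τ A
  ⊆-Cl {x = x} x∈A _ _ x∈U = x , x∈U , x∈A

  Cl-mono : ∀ {ℓ₁ ℓ₂} {A : Pred X ℓ₁} {B : Pred X ℓ₂} → A ⊆ B → Cl τ A ⊆ Cl τ B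
  Cl-mono A⊆B x∈ClA U oU x∈U with x∈ClA U oU x∈U
  ... | y , y∈U , y∈A = y , y∈U , A⊆B y∈A

  Cl-idem : ∀ {ℓ} {A : Pred X ℓ} → Cl τ (Cl τ A) ⊆ Cl τ A
  Cl-idem x∈ClClA U oU x∈U with x∈ClClA U oU x∈U
  ... | y , y∈U , y∈ClA = y∈ClA U oU y∈U

  Int-⊆ : ∀ {ℓ} {A : Pred X ℓ} → Int τ A ⊆ A
  Int-⊆ (_ , _ , x∈U , U⊆A) = U⊆A x∈U

  Int-mono : ∀ {ℓ₁ ℓ₂} {A : Pred X ℓ₁} {B : Pred X ℓ₂} → A ⊆ B → Int τ A ⊆ Int τ B
  Int-mono A⊆B (U , oU , x∈U , U⊆A) = U , oU , x∈U , λ u → A⊆B (U⊆A u)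

  Open⇒⊆IntCl : ∀ {U : Subset X} → Open U → U ⊆ Int τ (Cl τ U)
  Open⇒⊆IntCl {U} oU x∈U = U , oU , x∈U , ⊆-Cl

  ⊆Int⇒Open : ∀ {W : Subset X} → W ⊆ Int τ W → Open W
  ⊆Int⇒Open {W} W⊆IntW = Open-resp (⋃N⊆W , W⊆⋃N) (Open-⋃ N (λ (_ , w) → proj₁ (proj₂ (W⊆IntW w))))
    where
    N : Σ X W → Subset X
    N (_ , w) = proj₁ (W⊆IntW w)
    ⋃N⊆W : ⋃[ N ] ⊆ W
    ⋃N⊆W ((_ , w) , x∈N) = proj₂ (proj₂ (proj₂ (W⊆IntW w))) x∈N
    W⊆⋃N : W ⊆ ⋃[ N ]
    W⊆⋃N {x} w = (x , w) , proj₁ (proj₂ (proj₂ (W⊆IntW w)))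

  ≐IntCl⇒Cl⊆Cl : ∀ {W U : Subset X} → W ≐ Int τ (Cl τ U) → Cl τ W ⊆ Cl τ U
  ≐IntCl⇒Cl⊆Cl (W⊆ , _) x∈ClW = Cl-idem (Cl-mono (λ w → Int-⊆ (W⊆ w)) x∈ClW)

  ≐IntCl⇒IsRegularOpen : ∀ {W U : Subset X} → W ≐ Int τ (Cl τ U) → IsRegularOpen τ W
  ≐IntCl⇒IsRegularOpen {W} {U} W≐@(W⊆ , ⊆W) = oW , IntClW⊆W , Open⇒⊆IntCl oW
    where
    oW : Open W
    oW = ⊆Int⇒Open λ w → let (V , oV , x∈V , V⊆ClU) = W⊆ w in
                          V , oV , x∈V , λ v → ⊆W (V , oV , v , V⊆ClU)
    IntClW⊆W : Int τ (Cl τ W) ⊆ W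
    IntClW⊆W (V , oV , x∈V , V⊆ClW) = ⊆W (V , oV , x∈V , λ v → ≐IntCl⇒Cl⊆Cl W≐ (V⊆ClW v))

  Nested : Subset X → Subset X → Set₁
  Nested U V = (U ≐ V) ⊎ (Cl τ U ⊆ V) ⊎ (Cl τ V ⊆ U)

  Nested⇒⊆⊎≫ : ∀ {U V} → Nested U V → U ⊆ V ⊎ Cl τ V ⊆ U
  Nested⇒⊆⊎≫ (inj₁ (U⊆V , _))      = inj₁ U⊆V
  Nested⇒⊆⊎≫ (inj₂ (inj₁ ClU⊆V))   = inj₁ λ u → ClU⊆V (⊆-Cl u)
  Nested⇒⊆⊎≫ (inj₂ (inj₂ ClV⊆U))   = inj₂ ClV⊆U

  Nested-IntCl : ∀ {U V W W' : Subset X} → Open U → Open V →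
    W ≐ Int τ (Cl τ U) → W' ≐ Int τ (Cl τ V) → Nested U V → Nested W W'
  Nested-IntCl _ _ (W⊆ , ⊆W) (W'⊆ , ⊆W') (inj₁ (U⊆V , V⊆U)) =
    inj₁ ((λ w → ⊆W' (Int-mono (Cl-mono U⊆V) (W⊆ w))) ,
          (λ w → ⊆W (Int-mono (Cl-mono V⊆U) (W'⊆ w))))
  Nested-IntCl _ oV W≐ (_ , ⊆W') (inj₂ (inj₁ ClU⊆V)) =
    inj₂ (inj₁ λ x → ⊆W' (Open⇒⊆IntCl oV (ClU⊆V (≐IntCl⇒Cl⊆Cl W≐ x))))
  Nested-IntCl oU _ (_ , ⊆W) W'≐ (inj₂ (inj₂ ClV⊆U)) =
    inj₂ (inj₂ λ x → ⊆W (Open⇒⊆IntCl oU (ClV⊆U (≐IntCl⇒Cl⊆Cl W'≐ x))))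

module Classical (lem : ∀ ℓ → ExcludedMiddle ℓ) where

  dne : ∀ {ℓ} {P : Set ℓ} → ¬ ¬ P → P
  dne {ℓ} = em⇒dne (lem ℓ)

  -- Excluded middle makes every proposition equivalent to one in Set; this is how regions,
  -- which live in Subset X, are carved out of the large predicates Int (Cl U).
  Resize : ∀ {ℓ} → Set ℓ → Set
  Resize P = True (lem _ {P})

  resize : ∀ {ℓ} {P : Set ℓ} → P → Resize P
  resize = fromWitness

  unresize : ∀ {ℓ} {P : Set ℓ} → Resize P → P
  unresize = toWitness

  lower : ∀ {ℓ} {X : Set} → Pred X ℓ → Subset X
  lower A x = Resize (A x)

  lower≐ : ∀ {ℓ} {X : Set} (A : Pred X ℓ) → lower A ≐ A
  lower≐ A = unresize , resize

  ≉∅⇒Satisfiable : ∀ {X : Set} {A : Subset X} → ¬ (A ≐ ∅) → Satisfiable A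
  ≉∅⇒Satisfiable A≉∅ = dne λ unsat → A≉∅ ((λ {x} a → unsat (x , a)) , λ ())

  module _ {X : Set} (τ : Topology X) where
    open Topology τ

    T₁⇒Cl-singleton : T₁ τ → ∀ {p} → Cl τ ｛ p ｝ ⊆ ｛ p ｝
    T₁⇒Cl-singleton t₁ {p} {z} z∈Cl = dne λ p≢z →
      let (U , oU , z∈U , p∉U) = t₁ z p (λ z≡p → p≢z (sym z≡p))
          (y , y∈U , p≡y) = z∈Cl U oU z∈U
      in p∉U (subst U (sym p≡y) y∈U)

    AtomlessRO⇒¬Open-singleton : T₁ τ → AtomlessRO τ → ∀ p → ¬ Open ｛ p ｝
    AtomlessRO⇒¬Open-singleton t₁ atomless p o = atomless ｛ p ｝ (regular , (λ e → proj₁ e refl) , below)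
      where
      regular : IsRegularOpen τ ｛ p ｝
      regular = o , (λ x → T₁⇒Cl-singleton t₁ (Int-⊆ τ x)) , Open⇒⊆IntCl τ o
      below : ∀ y → IsRegularOpen τ y → y ⊆ ｛ p ｝ → (y ≐ ∅) ⊎ (y ≐ ｛ p ｝)
      below y _ y⊆p with lem _ {y p}
      ... | yes p∈y = inj₂ (y⊆p , λ p≡x → subst y p≡x p∈y)
      ... | no  p∉y = inj₁ ((λ x∈y → p∉y (subst y (sym (y⊆p x∈y)) x∈y)) , λ ())

    ¬Open-singleton⇒other-point : ∀ {p} {V : Subset X} → ¬ Open ｛ p ｝ → Open V → p ∈ V →
      ∃ λ q → q ∈ V × ¬ p ≡ q
    ¬Open-singleton⇒other-point {p} {V} ¬open oV p∈V = dne λ none →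
      ¬open (Open-resp ((λ {x} x∈V → dne λ p≢x → none (x , x∈V , p≢x)) , λ p≡x → subst V p≡x p∈V) oV)

    ⊆-localBasis⇒⊆-singleton : T₁ τ → ∀ {p ℬ} {A : Subset X} → IsLocalBasis τ p ℬ →
      (∀ V → V ∈ ℬ → A ⊆ V) → A ⊆ ｛ p ｝
    ⊆-localBasis⇒⊆-singleton t₁ {p} (_ , refines) A⊆ℬ {z} z∈A = dne λ p≢z →
      let (U , oU , p∈U , z∉U) = t₁ p z p≢z
          (V , V∈ℬ , V⊆U) = refines U oU p∈U
      in z∉U (V⊆U (A⊆ℬ V V∈ℬ z∈A))

    localBasis⇒IsAbstractive : T₁ τ → ∀ {p ℬ} → ¬ Open ｛ p ｝ → IsLocalBasis τ p ℬ →
      (∀ W → W ∈ ℬ → IsRegularOpen τ W) → (∀ U V → U ∈ ℬ → V ∈ ℬ → Nested τ U V) →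
      IsAbstractive τ ℬ
    localBasis⇒IsAbstractive t₁ {p} {ℬ} ¬open basis@(nbhd , _) regular nested =
      regular , (λ W W∈ℬ W≐∅ → proj₁ W≐∅ (proj₂ (nbhd W W∈ℬ))) , nested , no-lower-bound
      where
      no-lower-bound : ¬ (∃ λ x → IsRegularOpen τ x × Satisfiable x × (∀ y → y ∈ ℬ → x ⊆ y))
      no-lower-bound (x , (ox , _) , (y , y∈x) , x⊆ℬ) =
        ¬open (Open-resp (x⊆p , λ p≡z → subst x (subst (_≡ _) (x⊆p y∈x) p≡z) y∈x) ox)
        where
        x⊆p : x ⊆ ｛ p ｝
        x⊆p = ⊆-localBasis⇒⊆-singleton t₁ basis x⊆ℬ

    ⊴-localBasis⇒∈Cl : ∀ {p ℬ 𝒜} → IsLocalBasis τ p ℬ → IsAbstractive τ 𝒜 → _⊴_ τ 𝒜 ℬ →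
      ∀ b → b ∈ 𝒜 → p ∈ Cl τ b
    ⊴-localBasis⇒∈Cl (_ , refines) (_ , nonzero , nested , _) 𝒜⊴ℬ b b∈𝒜 U oU p∈U
      with refines U oU p∈U
    ... | W , W∈ℬ , W⊆U with 𝒜⊴ℬ W W∈ℬ
    ... | b' , b'∈𝒜 , b'⊆W with Nested⇒⊆⊎≫ τ (nested b' b b'∈𝒜 b∈𝒜)
    ... | inj₁ b'⊆b = let (y , y∈b') = ≉∅⇒Satisfiable (nonzero b' b'∈𝒜) in
                      y , W⊆U (b'⊆W y∈b') , b'⊆b y∈b'
    ... | inj₂ Clb⊆b' = let (y , y∈b) = ≉∅⇒Satisfiable (nonzero b b∈𝒜) in
                        y , W⊆U (b'⊆W (Clb⊆b' (⊆-Cl τ y∈b))) , y∈b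

    -- Some member of 𝒜 must be ≪ a, for otherwise a would be a lower bound of 𝒜, against (A).
    IsAbstractive-∈Cl⇒∈ : ∀ {p 𝒜} → IsAbstractive τ 𝒜 → (∀ b → b ∈ 𝒜 → p ∈ Cl τ b) →
      ∀ a → a ∈ 𝒜 → p ∈ a
    IsAbstractive-∈Cl⇒∈ {p} {𝒜} (regular , nonzero , nested , no-lower-bound) p∈Cl a a∈𝒜
      with lem _ {∃ λ b → b ∈ 𝒜 × Cl τ b ⊆ a}
    ... | yes (b , b∈𝒜 , Clb⊆a) = Clb⊆a (p∈Cl b b∈𝒜)
    ... | no ∄b = ⊥-elim (no-lower-bound (a , regular a a∈𝒜 , ≉∅⇒Satisfiable (nonzero a a∈𝒜) , a⊆𝒜))
      where
      a⊆𝒜 : ∀ b → b ∈ 𝒜 → a ⊆ b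
      a⊆𝒜 b b∈𝒜 with Nested⇒⊆⊎≫ τ (nested a b a∈𝒜 b∈𝒜)
      ... | inj₁ a⊆b   = a⊆b
      ... | inj₂ Clb⊆a = ⊥-elim (∄b (b , b∈𝒜 , Clb⊆a))

    localBasis-IsAbstractive⇒IsWRepresentative : ∀ {p ℬ} → IsLocalBasis τ p ℬ →
      IsAbstractive τ ℬ → IsWRepresentative τ ℬ
    localBasis-IsAbstractive⇒IsWRepresentative basis@(_ , refines) ℬ-abstractive =
      ℬ-abstractive , λ 𝒜 𝒜-abstractive 𝒜⊴ℬ a a∈𝒜 →
        let p∈a = IsAbstractive-∈Cl⇒∈ 𝒜-abstractive (⊴-localBasis⇒∈Cl basis 𝒜-abstractive 𝒜⊴ℬ) a a∈𝒜
        in refines a (proj₁ (proj₁ 𝒜-abstractive a a∈𝒜)) p∈a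

    module Regularization (t₁ : T₁ τ) {p : X} (¬open : ¬ Open ｛ p ｝)
      (ℬ : Pred (Subset X) 0ℓ) (basis : IsLocalBasis τ p ℬ)
      (nested : ∀ U V → U ∈ ℬ → V ∈ ℬ → Nested τ U V) where

      nbhd : ∀ U → U ∈ ℬ → Open U × p ∈ U
      nbhd = proj₁ basis

      refines : ∀ U → Open U → p ∈ U → ∃ λ V → V ∈ ℬ × V ⊆ U
      refines = proj₂ basis

      -- Pick q ≠ p in V and V' ∈ ℬ avoiding q; then V' ≐ V and Cl V ⊆ V' are impossible.
      shrink : ∀ V → V ∈ ℬ → ∃ λ V' → V' ∈ ℬ × Cl τ V' ⊆ V
      shrink V V∈ℬ with nbhd V V∈ℬ
      ... | oV , p∈V with ¬Open-singleton⇒other-point ¬open oV p∈V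
      ... | q , q∈V , p≢q with t₁ p q p≢q
      ... | O , oO , p∈O , q∉O with refines (V ∩ O) (Open-∩ oV oO) (p∈V , p∈O)
      ... | V' , V'∈ℬ , V'⊆V∩O with nested V' V V'∈ℬ V∈ℬ
      ... | inj₁ (_ , V⊆V')     = ⊥-elim (q∉O (proj₂ (V'⊆V∩O (V⊆V' q∈V))))
      ... | inj₂ (inj₁ ClV'⊆V)  = V' , V'∈ℬ , ClV'⊆V
      ... | inj₂ (inj₂ ClV⊆V')  = ⊥-elim (q∉O (proj₂ (V'⊆V∩O (ClV⊆V' (⊆-Cl τ q∈V)))))

      IsRegularization : Subset X → Set₁
      IsRegularization W = ∃ λ U → U ∈ ℬ × W ≐ Int τ (Cl τ U)

      ℛ : Pred (Subset X) 0ℓ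
      ℛ W = Resize (IsRegularization W)

      ℛ-regular : ∀ W → W ∈ ℛ → IsRegularOpen τ W
      ℛ-regular W W∈ℛ = ≐IntCl⇒IsRegularOpen τ (proj₂ (proj₂ (unresize W∈ℛ)))

      ℛ-nested : ∀ W W' → W ∈ ℛ → W' ∈ ℛ → Nested τ W W'
      ℛ-nested W W' W∈ℛ W'∈ℛ =
        let (U , U∈ℬ , W≐) = unresize W∈ℛ
            (V , V∈ℬ , W'≐) = unresize W'∈ℛ
        in Nested-IntCl τ (proj₁ (nbhd U U∈ℬ)) (proj₁ (nbhd V V∈ℬ)) W≐ W'≐ (nested U V U∈ℬ V∈ℬ)

      ℛ-localBasis : IsLocalBasis τ p ℛ
      ℛ-localBasis = ℛ-nbhd , ℛ-refines
        where
        ℛ-nbhd : ∀ W → W ∈ ℛ → Open W × p ∈ W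
        ℛ-nbhd W W∈ℛ =
          let (U , U∈ℬ , _ , ⊆W) = unresize W∈ℛ
              (oU , p∈U) = nbhd U U∈ℬ
          in proj₁ (ℛ-regular W W∈ℛ) , ⊆W (Open⇒⊆IntCl τ oU p∈U)
        ℛ-refines : ∀ U → Open U → p ∈ U → ∃ λ W → W ∈ ℛ × W ⊆ U
        ℛ-refines U oU p∈U =
          let (V , V∈ℬ , V⊆U) = refines U oU p∈U
              (V' , V'∈ℬ , ClV'⊆V) = shrink V V∈ℬ
          in lower (Int τ (Cl τ V')) , resize (V' , V'∈ℬ , lower≐ _) ,
             λ w → V⊆U (ClV'⊆V (Int-⊆ τ (unresize w)))

theorem3p6 : (lem : ∀ (ℓ : Level) → ExcludedMiddle ℓ) →
    {X : Set} (τ : Topology X) → Concentric τ → AtomlessRO τ →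
      ∀ (p : X) → ∃ λ (ℬ : Pred (Subset X) _) → IsLocalBasis τ p ℬ × IsWRepresentative τ ℬ
theorem3p6 lem τ (t₁ , concentric) atomless p =
  ℛ , ℛ-localBasis ,
  localBasis-IsAbstractive⇒IsWRepresentative τ ℛ-localBasis
    (localBasis⇒IsAbstractive τ t₁ ¬open ℛ-localBasis ℛ-regular ℛ-nested)
  where
  open Classical lem
  ¬open : ¬ Topology.Open τ ｛ p ｝
  ¬open = AtomlessRO⇒¬Open-singleton τ t₁ atomless p
  open Regularization τ t₁ ¬open (proj₁ (concentric p)) (proj₁ (proj₂ (concentric p)))
                      (proj₂ (proj₂ (concentric p)))
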